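{- Let $p$ be a prime, $A\in \mathbb{Z}^{m\times n}$ and $b\in \mathbb{Z}^m$. Then exactly one of the following holds: either $Ax=b$ has a $p$-adic solution $x$, or there exists $y\in\mathbb{R}^m$ such that $y^\top A$ is integral and $y^\top b$ is not a $p$-adic rational.
   Context: A $p$-adic rational is a number of the form $a/p^k$ with $a,k$ integers and $k\geq 0$; a vector is $p$-adic if all its entries are $p$-adic rationals.
   Formalization: The vector y in the second alternative has entries in ℚ rather than in ℝ. -}

module Defs where

open import Data.Nat using (ℕ; zero; suc; _^_)
open import Data.Integer using (ℤ; +_)
open import Data.Fin using (Fin; zero; suc)
open import Data.Product using (Σ; ∃; _×_)
open import Data.Sum using (_⊎_)
open import Relation.Nullary using (¬_)
open import Relation.Binary.PropositionalEquality using (_≡_)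
open import Data.Rational using (ℚ; 0ℚ; _+_; _*_; _/_)

ι : ℤ → ℚ
ι z = z / 1

∑ : ∀ {n} → (Fin n → ℚ) → ℚ
∑ {zero}  f = 0ℚ
∑ {suc n} f = f zero + ∑ (λ i → f (suc i))

-- q is a p-adic rational: q = a / p^k for some a ∈ ℤ, k ∈ ℕ,
-- written multiplicatively as q · p^k = a (avoids the p^k ≠ 0 side condition)
IsPAdic : ℕ → ℚ → Set
IsPAdic p q = Σ ℤ λ a → Σ ℕ λ k → q * ι (+ (p ^ k)) ≡ ι a

IsIntegral : ℚ → Set
IsIntegral q = Σ ℤ λ a → q ≡ ι a

HasPAdicSolution : ℕ → ∀ {m n} → (Fin m → Fin n → ℤ) → (Fin m → ℤ) → Set
HasPAdicSolution p {m} {n} A b =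
  Σ (Fin n → ℚ) λ x →
    ((j : Fin n) → IsPAdic p (x j)) ×
    ((i : Fin m) → ∑ (λ j → ι (A i j) * x j) ≡ ι (b i))

HasCertificate : ℕ → ∀ {m n} → (Fin m → Fin n → ℤ) → (Fin m → ℤ) → Set
HasCertificate p {m} {n} A b =
  Σ (Fin m → ℚ) λ y →
    ((j : Fin n) → IsIntegral (∑ (λ i → y i * ι (A i j)))) ×
    ¬ IsPAdic p (∑ (λ i → y i * ι (b i)))

{-# OPTIONS --safe #-}
-- If Ax = b with x p-adic and yᵀA is integral, then yᵀb = (yᵀA)x is a sum of products of integers
-- and p-adic rationals, so both alternatives cannot hold. For existence we run Gaussian elimination
-- over ℤ, allowing a p-adic rational right-hand side b. Unimodular integer column operations
-- (extended Euclid on two columns at a time) bring the first row to (g, 0, …, 0); solutions and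
-- certificates transport back along them. If g ≠ 0 and x₀ = b₀/g is p-adic we fix x₀ and recurse on
-- the minor with b′ = b − x₀·(first column); a certificate y′ of the minor extends by
-- y₀ = −(y′ · first column)/g. If b₀/g is not p-adic, y = e₀/g is a certificate. If g = 0 the first
-- row is zero: it is dropped when b₀ = 0, and otherwise y = e₀/((p+1)b₀) is a certificate, as 1/(p+1)
-- is not p-adic. Whether b₀/g is p-adic is decidable because, for p prime, a denominator d divides
-- some power of p iff it divides p ^ d.
module Submission where

open import Defs
open import Algebra.Bundles using (CommutativeRing)
import Algebra.Properties.Semiring.Sum
open import Data.Empty using (⊥-elim)
open import Data.Fin using (Fin; zero; suc)
open import Data.Fin.Properties using (_≟_; punchInᵢ≢i)
open import Data.List as List using (List; []; allFin)
open import Data.List.Membership.Propositional using (_∈_)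
open import Data.List.Membership.Propositional.Properties using (∈-allFin)
import Data.List.Relation.Unary.Any as Any
open import Data.Nat as ℕ using (ℕ; zero; suc; _^_; _∸_)
import Data.Nat.Properties as ℕP
open import Data.Nat.Coprimality as Coprimality using (Coprime; 1-coprimeTo; coprime-divisor)
open import Data.Nat.Divisibility
  using (_∣_; divides; _∣?_; ∣1⇒≡1; 1∣_; 0∣⇒≡0; *-cancelʳ-∣; *-monoˡ-∣; ∣-trans)
open import Data.Nat.Primality using (Prime; prime⇒nonZero; prime⇒nonTrivial; prime⇒irreducible)
open import Data.Integer as ℤ using (ℤ; +_; 0ℤ; 1ℤ)
import Data.Integer.Properties as ℤP
open import Data.Integer.DivMod using (n%d<d; a≡a%n+[a/n]*n)
open import Data.Integer.Tactic.RingSolver using (solve-∀)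
open import Data.Rational as ℚ
  using (ℚ; mkℚ; ↥_; ↧_; ↧ₙ_; 0ℚ; 1ℚ; toℚᵘ; _+_; _*_; -_; _-_; _/_; 1/_)
import Data.Rational.Properties as ℚP
open import Data.Rational.Solver using (module +-*-Solver)
open +-*-Solver using (solve; _:+_; _:*_; _:-_; :-_; _:=_)
import Data.Rational.Unnormalised as ℚᵘ
import Data.Rational.Unnormalised.Properties as ℚᵘP
open import Data.Product using (Σ; ∃; _×_; _,_)
open import Data.Sum as Sum using (_⊎_; inj₁; inj₂)
open import Data.Vec.Functional using (Vector; _∷_; tail; removeAt; updateAt)
open import Data.Vec.Functional.Properties using (updateAt-updates; updateAt-minimal)
open import Function using (_∘_; id; const)
open import Relation.Binary.PropositionalEquality
open import Relation.Nullary using (¬_; Dec; yes; no)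
open import Relation.Nullary.Decidable using (map′)

ι≡mkℚ : ∀ a → ι a ≡ mkℚ a 0 (Coprimality.sym (1-coprimeTo ℤ.∣ a ∣))
ι≡mkℚ a = ℚP.fromℚᵘ-toℚᵘ _

ι-injective : ∀ {a b} → ι a ≡ ι b → a ≡ b
ι-injective {a} {b} eq = trans (cong ↥_ (sym (ι≡mkℚ a))) (trans (cong ↥_ eq) (cong ↥_ (ι≡mkℚ b)))

-- On fractions with denominator 1, ℚ's _+_ and _*_ unfold to (…) / 1.
ι-+ : ∀ a b → ι (a ℤ.+ b) ≡ ι a + ι b
ι-+ a b = begin
  (a ℤ.+ b) / 1                  ≡⟨ cong (_/ 1) (cong₂ ℤ._+_ (ℤP.*-identityʳ a) (ℤP.*-identityʳ b)) ⟨
  (a ℤ.* + 1 ℤ.+ b ℤ.* + 1) / 1  ≡⟨ cong₂ _+_ (ι≡mkℚ a) (ι≡mkℚ b) ⟨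
  ι a + ι b                      ∎
  where open ≡-Reasoning

ι-* : ∀ a b → ι (a ℤ.* b) ≡ ι a * ι b
ι-* a b = sym (cong₂ _*_ (ι≡mkℚ a) (ι≡mkℚ b))

ι-neg : ∀ a → ι (ℤ.- a) ≡ - ι a
ι-neg a = trans (ι≡mkℚ (ℤ.- a)) (trans (neg-mkℚ a) (cong -_ (sym (ι≡mkℚ a))))
  where
  neg-mkℚ : ∀ a → mkℚ (ℤ.- a) 0 (Coprimality.sym (1-coprimeTo ℤ.∣ ℤ.- a ∣))
                ≡ - mkℚ a 0 (Coprimality.sym (1-coprimeTo ℤ.∣ a ∣))
  neg-mkℚ (+ 0)      = refl
  neg-mkℚ ℤ.+[1+ n ] = refl
  neg-mkℚ ℤ.-[1+ n ] = refl

ι-combination : ∀ a b c d → ι (a ℤ.* b ℤ.+ c ℤ.* d) ≡ ι a * ι b + ι c * ι d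
ι-combination a b c d = trans (ι-+ (a ℤ.* b) (c ℤ.* d)) (cong₂ _+_ (ι-* a b) (ι-* c d))

toℚᵘ-ι : ∀ a → toℚᵘ (ι a) ≡ ℚᵘ.mkℚᵘ a 0
toℚᵘ-ι a = cong toℚᵘ (ι≡mkℚ a)

toℚᵘ-*ι : ∀ q c → toℚᵘ (q * ι c) ℚᵘ.≃ toℚᵘ q ℚᵘ.* ℚᵘ.mkℚᵘ c 0
toℚᵘ-*ι q c = ℚᵘP.≃-trans (ℚP.toℚᵘ-homo-* q (ι c)) (ℚᵘP.≃-reflexive (cong (toℚᵘ q ℚᵘ.*_) (toℚᵘ-ι c)))

*ι≡ι⇒↥*≡*↧ : ∀ q c a → q * ι c ≡ ι a → ↥ q ℤ.* c ≡ a ℤ.* ↧ q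
*ι≡ι⇒↥*≡*↧ q@(mkℚ n d _) c a eq
  with ℚᵘP.≃-trans (ℚᵘP.≃-sym (toℚᵘ-*ι q c)) (ℚᵘP.≃-reflexive (trans (cong toℚᵘ eq) (toℚᵘ-ι a)))
... | ℚᵘ.*≡* cross = begin
  n ℤ.* c                ≡⟨ ℤP.*-identityʳ _ ⟨
  n ℤ.* c ℤ.* + 1        ≡⟨ cross ⟩
  a ℤ.* + suc (d ℕ.* 1)  ≡⟨ cong (λ e → a ℤ.* + suc e) (ℕP.*-identityʳ d) ⟩
  a ℤ.* + suc d          ∎
  where open ≡-Reasoning

↥*≡*↧⇒*ι≡ι : ∀ q c a → ↥ q ℤ.* c ≡ a ℤ.* ↧ q → q * ι c ≡ ι a
↥*≡*↧⇒*ι≡ι q@(mkℚ n d _) c a eq = ℚP.toℚᵘ-injective (begin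
  toℚᵘ (q * ι c)                 ≈⟨ toℚᵘ-*ι q c ⟩
  ℚᵘ.mkℚᵘ n d ℚᵘ.* ℚᵘ.mkℚᵘ c 0   ≈⟨ ℚᵘ.*≡* cross ⟩
  ℚᵘ.mkℚᵘ a 0                    ≡⟨ toℚᵘ-ι a ⟨
  toℚᵘ (ι a)                     ∎)
  where
  open ℚᵘP.≃-Reasoning
  cross : n ℤ.* c ℤ.* + 1 ≡ a ℤ.* + suc (d ℕ.* 1)
  cross = trans (ℤP.*-identityʳ _) (trans eq (cong (λ e → a ℤ.* + suc e) (sym (ℕP.*-identityʳ d))))

module ΣLib = Algebra.Properties.Semiring.Sum (CommutativeRing.semiring ℚP.+-*-commutativeRing)

∑≡sum : ∀ {n} (f : Vector ℚ n) → ∑ f ≡ ΣLib.sum f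
∑≡sum {zero}  f = refl
∑≡sum {suc n} f = cong (_+_ (f zero)) (∑≡sum (tail f))

∑-cong : ∀ {n} {f g : Vector ℚ n} → (∀ i → f i ≡ g i) → ∑ f ≡ ∑ g
∑-cong {f = f} {g} f≗g = trans (∑≡sum f) (trans (ΣLib.sum-cong-≗ f≗g) (sym (∑≡sum g)))

∑-zero : ∀ n → ∑ {n} (λ _ → 0ℚ) ≡ 0ℚ
∑-zero n = trans (∑≡sum {n} (λ _ → 0ℚ)) (ΣLib.sum-replicate-zero n)

∑-distrib-+ : ∀ {n} (f g : Vector ℚ n) → ∑ (λ i → f i + g i) ≡ ∑ f + ∑ g
∑-distrib-+ f g = begin
  ∑ (λ i → f i + g i)          ≡⟨ ∑≡sum (λ i → f i + g i) ⟩
  ΣLib.sum (λ i → f i + g i)   ≡⟨ ΣLib.∑-distrib-+ f g ⟩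
  ΣLib.sum f + ΣLib.sum g      ≡⟨ cong₂ _+_ (∑≡sum f) (∑≡sum g) ⟨
  ∑ f + ∑ g                    ∎
  where open ≡-Reasoning

∑-*ˡ : ∀ {n} c (f : Vector ℚ n) → ∑ (λ i → c * f i) ≡ c * ∑ f
∑-*ˡ c f = trans (∑≡sum (λ i → c * f i)) (trans (sym (ΣLib.*-distribˡ-sum c f)) (cong (c *_) (sym (∑≡sum f))))

∑-*ʳ : ∀ {n} (f : Vector ℚ n) c → ∑ (λ i → f i * c) ≡ ∑ f * c
∑-*ʳ f c = trans (∑≡sum (λ i → f i * c)) (trans (sym (ΣLib.*-distribʳ-sum c f)) (cong (_* c) (sym (∑≡sum f))))

∑-comm : ∀ {m n} (f : Fin m → Fin n → ℚ) → ∑ (λ i → ∑ (f i)) ≡ ∑ (λ j → ∑ (λ i → f i j))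
∑-comm f = begin
  ∑ (λ i → ∑ (f i))                        ≡⟨ ∑-cong (∑≡sum ∘ f) ⟩
  ∑ (λ i → ΣLib.sum (f i))                 ≡⟨ ∑≡sum (λ i → ΣLib.sum (f i)) ⟩
  ΣLib.sum (λ i → ΣLib.sum (f i))          ≡⟨ ΣLib.∑-comm f ⟩
  ΣLib.sum (λ j → ΣLib.sum (λ i → f i j))  ≡⟨ ∑≡sum (λ j → ΣLib.sum (λ i → f i j)) ⟨
  ∑ (λ j → ΣLib.sum (λ i → f i j))         ≡⟨ ∑-cong (λ j → ∑≡sum (λ i → f i j)) ⟨
  ∑ (λ j → ∑ (λ i → f i j))                ∎
  where open ≡-Reasoning

∑-remove : ∀ {n} (f : Vector ℚ (suc n)) k → ∑ f ≡ f k + ∑ (removeAt f k)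
∑-remove f k = trans (∑≡sum f) (trans (ΣLib.sum-remove {i = k} f) (cong (_+_ (f k)) (sym (∑≡sum (removeAt f k)))))

∑-cong-pair : ∀ {n} (k : Fin n) {f g : Vector ℚ (suc n)} → (∀ j → j ≢ k → f (suc j) ≡ g (suc j)) →
              f zero + f (suc k) ≡ g zero + g (suc k) → ∑ f ≡ ∑ g
∑-cong-pair {suc n} k {f} {g} f≗g pair = begin
  f zero + ∑ (tail f)                             ≡⟨ cong (_+_ (f zero)) (∑-remove (tail f) k) ⟩
  f zero + (f (suc k) + ∑ (removeAt (tail f) k))  ≡⟨ ℚP.+-assoc (f zero) _ _ ⟨
  f zero + f (suc k) + ∑ (removeAt (tail f) k)    ≡⟨ cong₂ _+_ pair (∑-cong (λ j → f≗g _ (punchInᵢ≢i k j))) ⟩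
  g zero + g (suc k) + ∑ (removeAt (tail g) k)    ≡⟨ ℚP.+-assoc (g zero) _ _ ⟩
  g zero + (g (suc k) + ∑ (removeAt (tail g) k))  ≡⟨ cong (_+_ (g zero)) (∑-remove (tail g) k) ⟨
  g zero + ∑ (tail g)                             ∎
  where open ≡-Reasoning

infix 8 _·_

_·_ : ∀ {n} → Vector ℚ n → Vector ℚ n → ℚ
u · v = ∑ λ i → u i * v i

·-congʳ : ∀ {n} (u : Vector ℚ n) {v w : Vector ℚ n} → (∀ i → v i ≡ w i) → u · v ≡ u · w
·-congʳ u v≗w = ∑-cong (λ i → cong (u i *_) (v≗w i))

·-zeroˡ : ∀ {n} {u : Vector ℚ n} (v : Vector ℚ n) → (∀ i → u i ≡ 0ℚ) → u · v ≡ 0ℚ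
·-zeroˡ {n} v u≗0 = trans (∑-cong (λ i → trans (cong (_* v i) (u≗0 i)) (ℚP.*-zeroˡ (v i)))) (∑-zero n)

·-distribˡ-+ : ∀ {n} (y u v : Vector ℚ n) → y · (λ i → u i + v i) ≡ y · u + y · v
·-distribˡ-+ y u v =
  trans (∑-cong (λ i → ℚP.*-distribˡ-+ (y i) (u i) (v i))) (∑-distrib-+ (λ i → y i * u i) (λ i → y i * v i))

·-*ʳ : ∀ {n} (y u : Vector ℚ n) c → y · (λ i → u i * c) ≡ y · u * c
·-*ʳ y u c = trans (∑-cong (λ i → sym (ℚP.*-assoc (y i) (u i) c))) (∑-*ʳ (λ i → y i * u i) c)

·-combination : ∀ {n} (y u v : Vector ℚ n) a c → y · (λ i → u i * a + v i * c) ≡ y · u * a + y · v * c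
·-combination y u v a c = trans (·-distribˡ-+ y _ _) (cong₂ _+_ (·-*ʳ y u a) (·-*ʳ y v c))

·-assoc : ∀ {m n} (y : Vector ℚ m) (M : Fin m → Fin n → ℚ) (x : Vector ℚ n) →
          y · (λ i → M i · x) ≡ (λ j → y · (λ i → M i j)) · x
·-assoc y M x = begin
  y · (λ i → M i · x)                      ≡⟨ ∑-cong (λ i → sym (∑-*ˡ (y i) (λ j → M i j * x j))) ⟩
  ∑ (λ i → ∑ (λ j → y i * (M i j * x j)))  ≡⟨ ∑-cong (λ i → ∑-cong (λ j → sym (ℚP.*-assoc (y i) (M i j) (x j)))) ⟩
  ∑ (λ i → ∑ (λ j → y i * M i j * x j))    ≡⟨ ∑-comm (λ i j → y i * M i j * x j) ⟩
  ∑ (λ j → ∑ (λ i → y i * M i j * x j))    ≡⟨ ∑-cong (λ j → ∑-*ʳ (λ i → y i * M i j) (x j)) ⟩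
  (λ j → y · (λ i → M i j)) · x            ∎
  where open ≡-Reasoning

0∷-· : ∀ {n} (y : Vector ℚ n) v → (0ℚ ∷ y) · v ≡ y · tail v
0∷-· y v = trans (cong (_+ y · tail v) (ℚP.*-zeroˡ (v zero))) (ℚP.+-identityˡ _)

∷0-· : ∀ {n} t (v : Vector ℚ (suc n)) → (t ∷ λ _ → 0ℚ) · v ≡ t * v zero
∷0-· t v = trans (cong (_+_ (t * v zero)) (·-zeroˡ (tail v) (λ _ → refl))) (ℚP.+-identityʳ _)

IsIntegral-+ : ∀ {q r} → IsIntegral q → IsIntegral r → IsIntegral (q + r)
IsIntegral-+ (a , refl) (b , refl) = a ℤ.+ b , sym (ι-+ a b)

IsIntegral-* : ∀ {q r} → IsIntegral q → IsIntegral r → IsIntegral (q * r)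
IsIntegral-* (a , refl) (b , refl) = a ℤ.* b , sym (ι-* a b)

module _ {p : ℕ} where

  private
    ιp^ : ℕ → ℚ
    ιp^ k = ι (+ (p ^ k))

    ιp^-+ : ∀ k l → ιp^ (k ℕ.+ l) ≡ ιp^ k * ιp^ l
    ιp^-+ k l = trans (cong (ι ∘ +_) (ℕP.^-distribˡ-+-* p k l))
                      (trans (cong ι (ℤP.pos-* (p ^ k) (p ^ l))) (ι-* (+ (p ^ k)) (+ (p ^ l))))

  IsIntegral⇒IsPAdic : ∀ {q} → IsIntegral q → IsPAdic p q
  IsIntegral⇒IsPAdic {q} (a , q≡a) = a , 0 , trans (ℚP.*-identityʳ q) q≡a

  IsPAdic-ι : ∀ a → IsPAdic p (ι a)
  IsPAdic-ι a = IsIntegral⇒IsPAdic (a , refl)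

  IsPAdic-+ : ∀ {q r} → IsPAdic p q → IsPAdic p r → IsPAdic p (q + r)
  IsPAdic-+ {q} {r} (a , k , qpᵏ≡a) (b , l , rpˡ≡b) = a ℤ.* + (p ^ l) ℤ.+ b ℤ.* + (p ^ k) , k ℕ.+ l , (begin
    (q + r) * ιp^ (k ℕ.+ l)                  ≡⟨ cong ((q + r) *_) (ιp^-+ k l) ⟩
    (q + r) * (ιp^ k * ιp^ l)                ≡⟨ solve 4 (λ q r s t → (q :+ r) :* (s :* t) := q :* s :* t :+ r :* t :* s)
                                                        refl q r (ιp^ k) (ιp^ l) ⟩
    q * ιp^ k * ιp^ l + r * ιp^ l * ιp^ k    ≡⟨ cong₂ (λ s t → s * ιp^ l + t * ιp^ k) qpᵏ≡a rpˡ≡b ⟩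
    ι a * ιp^ l + ι b * ιp^ k                ≡⟨ ι-combination a (+ (p ^ l)) b (+ (p ^ k)) ⟨
    ι (a ℤ.* + (p ^ l) ℤ.+ b ℤ.* + (p ^ k))  ∎)
    where open ≡-Reasoning

  IsPAdic-* : ∀ {q r} → IsPAdic p q → IsPAdic p r → IsPAdic p (q * r)
  IsPAdic-* {q} {r} (a , k , qpᵏ≡a) (b , l , rpˡ≡b) = a ℤ.* b , k ℕ.+ l , (begin
    q * r * ιp^ (k ℕ.+ l)    ≡⟨ cong (q * r *_) (ιp^-+ k l) ⟩
    q * r * (ιp^ k * ιp^ l)  ≡⟨ solve 4 (λ q r s t → q :* r :* (s :* t) := q :* s :* (r :* t)) refl q r (ιp^ k) (ιp^ l) ⟩
    q * ιp^ k * (r * ιp^ l)  ≡⟨ cong₂ _*_ qpᵏ≡a rpˡ≡b ⟩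
    ι a * ι b                ≡⟨ ι-* a b ⟨
    ι (a ℤ.* b)              ∎)
    where open ≡-Reasoning

  IsPAdic-neg : ∀ {q} → IsPAdic p q → IsPAdic p (- q)
  IsPAdic-neg {q} (a , k , qpᵏ≡a) =
    ℤ.- a , k , trans (sym (ℚP.neg-distribˡ-* q (ιp^ k))) (trans (cong -_ qpᵏ≡a) (sym (ι-neg a)))

  IsPAdic-∑ : ∀ {n} (f : Vector ℚ n) → (∀ i → IsPAdic p (f i)) → IsPAdic p (∑ f)
  IsPAdic-∑ {zero}  f _  = IsPAdic-ι 0ℤ
  IsPAdic-∑ {suc n} f pf = IsPAdic-+ {q = f zero} {∑ (tail f)} (pf zero) (IsPAdic-∑ (tail f) (pf ∘ suc))

  IsPAdic-combination : ∀ a c {u v} → IsPAdic p u → IsPAdic p v → IsPAdic p (ι a * u + ι c * v)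
  IsPAdic-combination a c {u} {v} pu pv =
    IsPAdic-+ {q = ι a * u} {ι c * v} (IsPAdic-* {q = ι a} {u} (IsPAdic-ι a) pu) (IsPAdic-* {q = ι c} {v} (IsPAdic-ι c) pv)

  IsPAdic⇒↧∣p^ : ∀ q → IsPAdic p q → ∃ λ k → ↧ₙ q ∣ p ^ k
  IsPAdic⇒↧∣p^ q@(mkℚ n d n⊥d) (a , k , qpᵏ≡a) =
    k , coprime-divisor (Coprimality.sym (Coprimality.recompute n⊥d)) ↧∣∣n∣pᵏ
    where
    ↧∣∣n∣pᵏ : suc d ∣ ℤ.∣ n ∣ ℕ.* p ^ k
    ↧∣∣n∣pᵏ = divides ℤ.∣ a ∣ (begin
      ℤ.∣ n ∣ ℕ.* p ^ k      ≡⟨ ℤP.abs-* n (+ (p ^ k)) ⟨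
      ℤ.∣ n ℤ.* + (p ^ k) ∣  ≡⟨ cong ℤ.∣_∣ (*ι≡ι⇒↥*≡*↧ q (+ (p ^ k)) a qpᵏ≡a) ⟩
      ℤ.∣ a ℤ.* + suc d ∣    ≡⟨ ℤP.abs-* a (+ suc d) ⟩
      ℤ.∣ a ∣ ℕ.* suc d      ∎)
      where open ≡-Reasoning

  ↧∣p^⇒IsPAdic : ∀ q {k} → ↧ₙ q ∣ p ^ k → IsPAdic p q
  ↧∣p^⇒IsPAdic q@(mkℚ n d _) {k} (divides c pᵏ≡c↧) =
    n ℤ.* + c , k , ↥*≡*↧⇒*ι≡ι q (+ (p ^ k)) (n ℤ.* + c) (begin
      n ℤ.* + (p ^ k)          ≡⟨ cong (λ e → n ℤ.* + e) pᵏ≡c↧ ⟩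
      n ℤ.* + (c ℕ.* suc d)    ≡⟨ cong (n ℤ.*_) (ℤP.pos-* c (suc d)) ⟩
      n ℤ.* (+ c ℤ.* + suc d)  ≡⟨ ℤP.*-assoc n (+ c) (+ suc d) ⟨
      n ℤ.* + c ℤ.* + suc d    ∎)
    where open ≡-Reasoning

  p^-mono-∣ : ∀ {k l} → k ℕ.≤ l → p ^ k ∣ p ^ l
  p^-mono-∣ {k} {l} k≤l =
    divides (p ^ (l ∸ k)) (trans (cong (p ^_) (sym (ℕP.m∸n+n≡m k≤l))) (ℕP.^-distribˡ-+-* p (l ∸ k) k))

  coprime∧∣p^⇒∣1 : ∀ {d} k → Coprime d p → d ∣ p ^ k → d ∣ 1
  coprime∧∣p^⇒∣1 zero    _   d∣1    = d∣1
  coprime∧∣p^⇒∣1 (suc k) d⊥p d∣pᵏ⁺¹ = coprime∧∣p^⇒∣1 k d⊥p (coprime-divisor d⊥p d∣pᵏ⁺¹)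

1/[1+_] : ℕ → ℚ
1/[1+ n ] = mkℚ (+ 1) n (1-coprimeTo (suc n))

module _ {p : ℕ} (p-prime : Prime p) where

  private instance
    p≢0 : ℕ.NonZero p
    p≢0 = prime⇒nonZero p-prime

  ¬∣⇒coprime : ∀ {d} → ¬ p ∣ d → Coprime d p
  ¬∣⇒coprime p∤d (i∣d , i∣p) with prime⇒irreducible p-prime i∣p
  ... | inj₁ i≡1  = i≡1
  ... | inj₂ refl = ⊥-elim (p∤d i∣d)

  -- d ∣ p ^ k forces d = p ^ j for some j, and j < p ^ j = d.
  ∣p^⇒∣p^self : ∀ k d → d ∣ p ^ k → d ∣ p ^ d
  ∣p^⇒∣p^self zero    d d∣1 = subst (λ e → e ∣ p ^ e) (sym (∣1⇒≡1 d∣1)) (1∣ _)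
  ∣p^⇒∣p^self (suc k) d d∣pᵏ⁺¹ with p ∣? d
  ... | no  p∤d                 = ∣p^⇒∣p^self k d (coprime-divisor (¬∣⇒coprime p∤d) d∣pᵏ⁺¹)
  ... | yes (divides zero refl) = ⊥-elim (ℕ.≢-nonZero⁻¹ (p ^ suc k) {{ℕP.m^n≢0 p (suc k)}} (0∣⇒≡0 d∣pᵏ⁺¹))
  ... | yes (divides e@(suc e′) refl) = ∣-trans ep∣pᵉ⁺¹ (p^-mono-∣ 1+e≤ep)
    where
    e∣pᵉ : e ∣ p ^ e
    e∣pᵉ = ∣p^⇒∣p^self k e (*-cancelʳ-∣ p (subst (e ℕ.* p ∣_) (ℕP.*-comm p (p ^ k)) d∣pᵏ⁺¹))
    ep∣pᵉ⁺¹ : e ℕ.* p ∣ p ^ suc e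
    ep∣pᵉ⁺¹ = subst (e ℕ.* p ∣_) (ℕP.*-comm (p ^ e) p) (*-monoˡ-∣ p e∣pᵉ)
    1+e≤ep : suc e ℕ.≤ e ℕ.* p
    1+e≤ep = ℕP.≤-trans (ℕ.s≤s (ℕ.s≤s (ℕP.m≤m*n e′ 2)))
                        (ℕP.*-monoʳ-≤ e (ℕ.nonTrivial⇒n>1 p {{prime⇒nonTrivial p-prime}}))

  IsPAdic? : ∀ q → Dec (IsPAdic p q)
  IsPAdic? q = map′ (↧∣p^⇒IsPAdic q {↧ₙ q})
                    (λ pq → let k , ↧∣pᵏ = IsPAdic⇒↧∣p^ q pq in ∣p^⇒∣p^self k _ ↧∣pᵏ)
                    (↧ₙ q ∣? p ^ ↧ₙ q)

  ¬IsPAdic-1/[1+p] : ¬ IsPAdic p 1/[1+ p ]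
  ¬IsPAdic-1/[1+p] pq with IsPAdic⇒↧∣p^ 1/[1+ p ] pq
  ... | k , 1+p∣pᵏ = ℕ.≢-nonZero⁻¹ p (ℕP.suc-injective (∣1⇒≡1 (coprime∧∣p^⇒∣1 k 1+p⊥p 1+p∣pᵏ)))
    where
    1+p⊥p : Coprime (suc p) p
    1+p⊥p = subst (λ e → Coprime e p) (ℕP.+-comm p 1) (Coprimality.coprime-+ (1-coprimeTo p))

Matrix : ℕ → ℕ → Set
Matrix m n = Fin m → Fin n → ℤ

minor : ∀ {m n} → Matrix (suc m) (suc n) → Matrix m n
minor A i j = A (suc i) (suc j)

-- The notions of Defs with a rational right-hand side: eliminating a pivot turns an integral b
-- into a p-adic one.
HasPAdicSolutionℚ : ℕ → ∀ {m n} → Matrix m n → Vector ℚ m → Set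
HasPAdicSolutionℚ p {m} {n} A b =
  Σ (Vector ℚ n) λ x → (∀ j → IsPAdic p (x j)) × (∀ i → (ι ∘ A i) · x ≡ b i)

HasCertificateℚ : ℕ → ∀ {m n} → Matrix m n → Vector ℚ m → Set
HasCertificateℚ p {m} {n} A b =
  Σ (Vector ℚ m) λ y → (∀ j → IsIntegral (y · λ i → ι (A i j))) × ¬ IsPAdic p (y · b)

Alternative : ℕ → ∀ {m n} → Matrix m n → Vector ℚ m → Set
Alternative p A b = HasPAdicSolutionℚ p A b ⊎ HasCertificateℚ p A b

solution⇒¬certificate : ∀ {p m n} {A : Matrix m n} {b} → HasPAdicSolutionℚ p A b → ¬ HasCertificateℚ p A b
solution⇒¬certificate {p} {A = A} {b} (x , x-padic , Ax≡b) (y , yA-int , yb-not-padic) =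
  yb-not-padic (subst (IsPAdic p) (sym yb≡yAx) (IsPAdic-∑ _ yAⱼxⱼ-padic))
  where
  yb≡yAx : y · b ≡ (λ j → y · λ i → ι (A i j)) · x
  yb≡yAx = trans (·-congʳ y (sym ∘ Ax≡b)) (·-assoc y (λ i j → ι (A i j)) x)
  yAⱼxⱼ-padic : ∀ j → IsPAdic p ((y · λ i → ι (A i j)) * x j)
  yAⱼxⱼ-padic j = IsPAdic-* {q = y · λ i → ι (A i j)} {x j} (IsIntegral⇒IsPAdic (yA-int j)) (x-padic j)

record Reduction (p : ℕ) {m n} (A A′ : Matrix m n) : Set where
  field
    solution    : ∀ {b} → HasPAdicSolutionℚ p A′ b → HasPAdicSolutionℚ p A b
    certificate : ∀ {b} → HasCertificateℚ p A′ b → HasCertificateℚ p A b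

  alternative : ∀ {b} → Alternative p A′ b → Alternative p A b
  alternative = Sum.map solution certificate

Reduction-refl : ∀ {p m n} {A : Matrix m n} → Reduction p A A
Reduction-refl = record { solution = id ; certificate = id }

Reduction-trans : ∀ {p m n} {A B C : Matrix m n} → Reduction p A B → Reduction p B C → Reduction p A C
Reduction-trans A⇝B B⇝C = record
  { solution    = Reduction.solution A⇝B ∘ Reduction.solution B⇝C
  ; certificate = Reduction.certificate A⇝B ∘ Reduction.certificate B⇝C
  }

-- Unimodular column operations

record Matrix₂ : Set where
  field α β γ δ : ℤ

det : Matrix₂ → ℤ
det U = α ℤ.* δ ℤ.- β ℤ.* γ
  where open Matrix₂ U

adjugate : Matrix₂ → Matrix₂
adjugate U = record { α = δ ; β = ℤ.- β ; γ = ℤ.- γ ; δ = α }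
  where open Matrix₂ U

-- With E the identity matrix carrying U = [α β; γ δ] in rows and columns zero and suc k,
-- mixRow U k r is the row r E and mixEntries U k x is the column E x.
mixRow : ∀ {n} → Matrix₂ → Fin n → Vector ℤ (suc n) → Vector ℤ (suc n)
mixRow U k r = (r zero ℤ.* α ℤ.+ r (suc k) ℤ.* γ) ∷ updateAt (tail r) k (const (r zero ℤ.* β ℤ.+ r (suc k) ℤ.* δ))
  where open Matrix₂ U

mixEntries : ∀ {n} → Matrix₂ → Fin n → Vector ℚ (suc n) → Vector ℚ (suc n)
mixEntries U k x = (ι α * x zero + ι β * x (suc k)) ∷ updateAt (tail x) k (const (ι γ * x zero + ι δ * x (suc k)))
  where open Matrix₂ U

·-mixEntries : ∀ {n} U (k : Fin n) r x → (ι ∘ r) · mixEntries U k x ≡ (ι ∘ mixRow U k r) · x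
·-mixEntries U k r x = ∑-cong-pair k {λ l → ι (r l) * mixEntries U k x l} {λ l → ι (mixRow U k r l) * x l}
  (λ j j≢k → cong₂ _*_ (cong ι (sym (updateAt-minimal j k (tail r) j≢k))) (updateAt-minimal j k (tail x) j≢k))
  (begin
    ι a * (ι α * X + ι β * Y) + ι c * mixEntries U k x (suc k)
      ≡⟨ cong (λ z → ι a * (ι α * X + ι β * Y) + ι c * z) (updateAt-updates k (tail x)) ⟩
    ι a * (ι α * X + ι β * Y) + ι c * (ι γ * X + ι δ * Y)
      ≡⟨ solve 8 (λ a c α β γ δ X Y → a :* (α :* X :+ β :* Y) :+ c :* (γ :* X :+ δ :* Y)
                                     := (a :* α :+ c :* γ) :* X :+ (a :* β :+ c :* δ) :* Y)
               refl (ι a) (ι c) (ι α) (ι β) (ι γ) (ι δ) X Y ⟩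
    (ι a * ι α + ι c * ι γ) * X + (ι a * ι β + ι c * ι δ) * Y
      ≡⟨ cong₂ (λ s t → s * X + t * Y) (ι-combination a α c γ) (ι-combination a β c δ) ⟨
    ι (a ℤ.* α ℤ.+ c ℤ.* γ) * X + ι (a ℤ.* β ℤ.+ c ℤ.* δ) * Y
      ≡⟨ cong (λ z → ι (a ℤ.* α ℤ.+ c ℤ.* γ) * X + ι z * Y) (updateAt-updates k (tail r)) ⟨
    ι (a ℤ.* α ℤ.+ c ℤ.* γ) * X + ι (mixRow U k r (suc k)) * Y
      ∎)
  where
  open Matrix₂ U
  open ≡-Reasoning
  a = r zero
  c = r (suc k)
  X = x zero
  Y = x (suc k)

mixRow-adjugate : ∀ {n} U (k : Fin n) → det U ≡ 1ℤ → ∀ r l → mixRow (adjugate U) k (mixRow U k r) l ≡ r l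
mixRow-adjugate U k det≡1 r zero = begin
  (a ℤ.* α ℤ.+ c ℤ.* γ) ℤ.* δ ℤ.+ mixRow U k r (suc k) ℤ.* ℤ.- γ
    ≡⟨ cong (λ z → (a ℤ.* α ℤ.+ c ℤ.* γ) ℤ.* δ ℤ.+ z ℤ.* ℤ.- γ) (updateAt-updates k (tail r)) ⟩
  (a ℤ.* α ℤ.+ c ℤ.* γ) ℤ.* δ ℤ.+ (a ℤ.* β ℤ.+ c ℤ.* δ) ℤ.* ℤ.- γ
    ≡⟨ identity a c α β γ δ ⟩
  a ℤ.* det U
    ≡⟨ trans (cong (a ℤ.*_) det≡1) (ℤP.*-identityʳ a) ⟩
  a ∎
  where
  open Matrix₂ U
  open ≡-Reasoning
  a = r zero
  c = r (suc k)
  identity : ∀ a c α β γ δ →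
             (a ℤ.* α ℤ.+ c ℤ.* γ) ℤ.* δ ℤ.+ (a ℤ.* β ℤ.+ c ℤ.* δ) ℤ.* ℤ.- γ ≡ a ℤ.* (α ℤ.* δ ℤ.- β ℤ.* γ)
  identity = solve-∀
mixRow-adjugate U k det≡1 r (suc j) with j ≟ k
... | yes refl = begin
  mixRow (adjugate U) j (mixRow U j r) (suc j)
    ≡⟨ updateAt-updates j (tail (mixRow U j r)) ⟩
  (a ℤ.* α ℤ.+ c ℤ.* γ) ℤ.* ℤ.- β ℤ.+ mixRow U j r (suc j) ℤ.* α
    ≡⟨ cong (λ z → (a ℤ.* α ℤ.+ c ℤ.* γ) ℤ.* ℤ.- β ℤ.+ z ℤ.* α) (updateAt-updates j (tail r)) ⟩
  (a ℤ.* α ℤ.+ c ℤ.* γ) ℤ.* ℤ.- β ℤ.+ (a ℤ.* β ℤ.+ c ℤ.* δ) ℤ.* α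
    ≡⟨ identity a c α β γ δ ⟩
  c ℤ.* det U
    ≡⟨ trans (cong (c ℤ.*_) det≡1) (ℤP.*-identityʳ c) ⟩
  c ∎
  where
  open Matrix₂ U
  open ≡-Reasoning
  a = r zero
  c = r (suc j)
  identity : ∀ a c α β γ δ →
             (a ℤ.* α ℤ.+ c ℤ.* γ) ℤ.* ℤ.- β ℤ.+ (a ℤ.* β ℤ.+ c ℤ.* δ) ℤ.* α ≡ c ℤ.* (α ℤ.* δ ℤ.- β ℤ.* γ)
  identity = solve-∀
... | no j≢k = trans (updateAt-minimal j k (tail (mixRow U k r)) j≢k) (updateAt-minimal j k (tail r) j≢k)

IsIntegral-·-combination : ∀ {m} (y : Vector ℚ m) (u v : Vector ℤ m) →
                           IsIntegral (y · (ι ∘ u)) → IsIntegral (y · (ι ∘ v)) →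
                           ∀ a c → IsIntegral (y · λ i → ι (u i ℤ.* a ℤ.+ v i ℤ.* c))
IsIntegral-·-combination y u v yu-int yv-int a c = subst IsIntegral (sym y·combination)
  (IsIntegral-+ (IsIntegral-* yu-int (a , refl)) (IsIntegral-* yv-int (c , refl)))
  where
  y·combination : y · (λ i → ι (u i ℤ.* a ℤ.+ v i ℤ.* c)) ≡ y · (ι ∘ u) * ι a + y · (ι ∘ v) * ι c
  y·combination = trans (·-congʳ y (λ i → ι-combination (u i) a (v i) c)) (·-combination y (ι ∘ u) (ι ∘ v) (ι a) (ι c))

IsIntegral-·-mixRow : ∀ {m n} U (k : Fin n) (A : Matrix m (suc n)) y → (∀ l → IsIntegral (y · λ i → ι (A i l))) →
                      ∀ l → IsIntegral (y · λ i → ι (mixRow U k (A i) l))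
IsIntegral-·-mixRow U k A y yA-int zero =
  IsIntegral-·-combination y (λ i → A i zero) (λ i → A i (suc k)) (yA-int zero) (yA-int (suc k)) (Matrix₂.α U) (Matrix₂.γ U)
IsIntegral-·-mixRow U k A y yA-int (suc j) with j ≟ k
... | yes refl = subst IsIntegral (·-congʳ y (λ i → cong ι (sym (updateAt-updates j (tail (A i))))))
  (IsIntegral-·-combination y (λ i → A i zero) (λ i → A i (suc j)) (yA-int zero) (yA-int (suc j)) (Matrix₂.β U) (Matrix₂.δ U))
... | no j≢k = subst IsIntegral (·-congʳ y (λ i → cong ι (sym (updateAt-minimal j k (tail (A i)) j≢k)))) (yA-int (suc j))

IsPAdic-mixEntries : ∀ {p n} U (k : Fin n) {x} → (∀ j → IsPAdic p (x j)) → ∀ l → IsPAdic p (mixEntries U k x l)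
IsPAdic-mixEntries U k px zero = IsPAdic-combination (Matrix₂.α U) (Matrix₂.β U) (px zero) (px (suc k))
IsPAdic-mixEntries {p} U k {x} px (suc j) with j ≟ k
... | yes refl = subst (IsPAdic p) (sym (updateAt-updates j (tail x)))
                   (IsPAdic-combination (Matrix₂.γ U) (Matrix₂.δ U) (px zero) (px (suc j)))
... | no j≢k   = subst (IsPAdic p) (sym (updateAt-minimal j k (tail x) j≢k)) (px (suc j))

-- Certificates transport because yᵀA = (yᵀ A E) E⁻¹, and E⁻¹ is integral since det U = 1.
mixRow-reduction : ∀ {p m n} {A : Matrix m (suc n)} U (k : Fin n) → det U ≡ 1ℤ → Reduction p A (mixRow U k ∘ A)
mixRow-reduction {A = A} U k det≡1 = record
  { solution    = λ (x , x-padic , eqs) →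
      mixEntries U k x , IsPAdic-mixEntries U k {x} x-padic , λ i → trans (·-mixEntries U k (A i) x) (eqs i)
  ; certificate = λ (y , yA′-int , yb-not-padic) →
      y , (λ l → subst IsIntegral (·-congʳ y (λ i → cong ι (mixRow-adjugate U k det≡1 (A i) l)))
                   (IsIntegral-·-mixRow (adjugate U) k (mixRow U k ∘ A) y yA′-int l))
        , yb-not-padic
  }

record Eliminator (a c : ℤ) : Set where
  field
    matrix     : Matrix₂
    unimodular : det matrix ≡ 1ℤ
    clears     : a ℤ.* Matrix₂.β matrix ℤ.+ c ℤ.* Matrix₂.δ matrix ≡ 0ℤ

eliminator-zero : ∀ a → Eliminator a 0ℤ
eliminator-zero a = record
  { matrix     = record { α = 1ℤ ; β = 0ℤ ; γ = 0ℤ ; δ = 1ℤ }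
  ; unimodular = refl
  ; clears     = identity a
  }
  where
  identity : ∀ a → a ℤ.* 0ℤ ℤ.+ 0ℤ ℤ.* 1ℤ ≡ 0ℤ
  identity = solve-∀

-- With a = q c + r, the new matrix is [0 1; 1 -q] U′ with its first column negated to make det = 1.
eliminator-step : ∀ a c .{{_ : ℤ.NonZero c}} → Eliminator c (+ (a ℤ.% c)) → Eliminator a c
eliminator-step a c E′ = record
  { matrix     = record { α = ℤ.- γ′ ; β = δ′ ; γ = q ℤ.* γ′ ℤ.- α′ ; δ = β′ ℤ.- q ℤ.* δ′ }
  ; unimodular = trans (det-identity α′ β′ γ′ δ′ q) unimodular
  ; clears     = begin
      a ℤ.* δ′ ℤ.+ c ℤ.* (β′ ℤ.- q ℤ.* δ′)
        ≡⟨ cong (λ a → a ℤ.* δ′ ℤ.+ c ℤ.* (β′ ℤ.- q ℤ.* δ′)) (a≡a%n+[a/n]*n a c) ⟩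
      (r ℤ.+ q ℤ.* c) ℤ.* δ′ ℤ.+ c ℤ.* (β′ ℤ.- q ℤ.* δ′)
        ≡⟨ clears-identity r q c β′ δ′ ⟩
      c ℤ.* β′ ℤ.+ r ℤ.* δ′
        ≡⟨ clears ⟩
      0ℤ ∎
  }
  where
  open Eliminator E′
  open Matrix₂ matrix renaming (α to α′; β to β′; γ to γ′; δ to δ′)
  open ≡-Reasoning
  q = a ℤ./ c
  r = + (a ℤ.% c)
  det-identity : ∀ α′ β′ γ′ δ′ q →
                 ℤ.- γ′ ℤ.* (β′ ℤ.- q ℤ.* δ′) ℤ.- δ′ ℤ.* (q ℤ.* γ′ ℤ.- α′) ≡ α′ ℤ.* δ′ ℤ.- β′ ℤ.* γ′
  det-identity = solve-∀
  clears-identity : ∀ r q c β′ δ′ →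
                    (r ℤ.+ q ℤ.* c) ℤ.* δ′ ℤ.+ c ℤ.* (β′ ℤ.- q ℤ.* δ′) ≡ c ℤ.* β′ ℤ.+ r ℤ.* δ′
  clears-identity = solve-∀

eliminator : ∀ a c → Eliminator a c
eliminator a c = euclid (suc ℤ.∣ c ∣) a c ℕP.≤-refl
  where
  euclid : ∀ fuel a c → ℤ.∣ c ∣ ℕ.< fuel → Eliminator a c
  euclid (suc fuel) a c (ℕ.s≤s ∣c∣≤fuel) with c ℤP.≟ 0ℤ
  ... | yes refl = eliminator-zero a
  ... | no c≢0   = eliminator-step a c {{ℤ.≢-nonZero c≢0}}
                     (euclid fuel c _ (ℕP.<-≤-trans (n%d<d a c {{ℤ.≢-nonZero c≢0}}) ∣c∣≤fuel))

-- Elimination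

module _ {p : ℕ} where

  clearColumns : ∀ {m n} (A : Matrix (suc m) (suc n)) (ks : List (Fin n)) →
                 ∃ λ A′ → Reduction p A A′ × (∀ {j} → j ∈ ks → A′ zero (suc j) ≡ 0ℤ)
  clearColumns A []            = A , Reduction-refl , λ ()
  clearColumns A (k List.∷ ks) with clearColumns A ks
  ... | A₁ , A⇝A₁ , A₁-cleared =
    mixRow matrix k ∘ A₁ , Reduction-trans A⇝A₁ (mixRow-reduction matrix k unimodular) , cleared
    where
    open Eliminator (eliminator (A₁ zero zero) (A₁ zero (suc k)))
    cleared : ∀ {j} → j ∈ k List.∷ ks → mixRow matrix k (A₁ zero) (suc j) ≡ 0ℤ
    cleared {j} j∈k∷ks with j ≟ k
    ... | yes refl = trans (updateAt-updates k (tail (A₁ zero))) clears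
    ... | no j≢k   = trans (updateAt-minimal j k (tail (A₁ zero)) j≢k) (A₁-cleared (Any.tail j≢k j∈k∷ks))

  clearFirstRow : ∀ {m n} (A : Matrix (suc m) (suc n)) →
                  ∃ λ A′ → Reduction p A A′ × (∀ j → A′ zero (suc j) ≡ 0ℤ)
  clearFirstRow {n = n} A with clearColumns A (allFin n)
  ... | A′ , A⇝A′ , cleared = A′ , A⇝A′ , λ j → cleared (∈-allFin j)

  singleRowCertificate : ∀ {m n} {A : Matrix (suc m) n} {b} t → (∀ j → IsIntegral (t * ι (A zero j))) →
                         ¬ IsPAdic p (t * b zero) → HasCertificateℚ p A b
  singleRowCertificate {A = A} {b} t tA-int tb-not-padic =
      (t ∷ λ _ → 0ℚ)
    , (λ j → subst IsIntegral (sym (∷0-· t λ i → ι (A i j))) (tA-int j))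
    , tb-not-padic ∘ subst (IsPAdic p) (∷0-· t b)

  module DropZeroRow {m n} {A : Matrix (suc m) n} {b : Vector ℚ (suc m)} (row-zero : ∀ j → A zero j ≡ 0ℤ) where

    solution : b zero ≡ 0ℚ → HasPAdicSolutionℚ p (tail A) (tail b) → HasPAdicSolutionℚ p A b
    solution b₀≡0 (x , x-padic , eqs) = x , x-padic , λ
      { zero    → trans (·-zeroˡ x (λ j → cong ι (row-zero j))) (sym b₀≡0)
      ; (suc i) → eqs i
      }

    certificate : HasCertificateℚ p (tail A) (tail b) → HasCertificateℚ p A b
    certificate (y , yA-int , yb-not-padic) =
        0ℚ ∷ y
      , (λ j → subst IsIntegral (sym (0∷-· y λ i → ι (A i j))) (yA-int j))
      , yb-not-padic ∘ subst (IsPAdic p) (0∷-· y b)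

  module Pivot {m n} (A : Matrix (suc m) (suc n)) (b : Vector ℚ (suc m))
               (g≢0 : A zero zero ≢ 0ℤ) (row-cleared : ∀ j → A zero (suc j) ≡ 0ℤ) where

    g : ℚ
    g = ι (A zero zero)

    instance
      g-nonZero : ℚ.NonZero g
      g-nonZero = ℚ.≢-nonZero (g≢0 ∘ ι-injective)

    x₀ : ℚ
    x₀ = b zero * 1/ g

    b′ : Vector ℚ m
    b′ i = b (suc i) + ι (A (suc i) zero) * - x₀

    b′-padic : (∀ i → IsPAdic p (b i)) → IsPAdic p x₀ → ∀ i → IsPAdic p (b′ i)
    b′-padic b-padic x₀-padic i = IsPAdic-+ {q = b (suc i)} (b-padic (suc i))
      (IsPAdic-* {q = ι (A (suc i) zero)} (IsPAdic-ι (A (suc i) zero)) (IsPAdic-neg {q = x₀} x₀-padic))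

    certificate-for-x₀ : ¬ IsPAdic p x₀ → HasCertificateℚ p A b
    certificate-for-x₀ x₀-not-padic =
      singleRowCertificate {A = A} {b} (1/ g) tA-int (x₀-not-padic ∘ subst (IsPAdic p) (ℚP.*-comm (1/ g) (b zero)))
      where
      tA-int : ∀ j → IsIntegral (1/ g * ι (A zero j))
      tA-int zero    = 1ℤ , ℚP.*-inverseˡ g
      tA-int (suc j) = 0ℤ , trans (cong (λ a → 1/ g * ι a) (row-cleared j)) (ℚP.*-zeroʳ (1/ g))

    solution : IsPAdic p x₀ → HasPAdicSolutionℚ p (minor A) b′ → HasPAdicSolutionℚ p A b
    solution x₀-padic (x , x-padic , eqs) = x₀ ∷ x , (λ { zero → x₀-padic ; (suc j) → x-padic j }) , λ
      { zero    → begin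
          g * x₀ + (ι ∘ tail (A zero)) · x  ≡⟨ cong (_+_ (g * x₀)) (·-zeroˡ x (λ j → cong ι (row-cleared j))) ⟩
          g * x₀ + 0ℚ                       ≡⟨ ℚP.+-identityʳ (g * x₀) ⟩
          g * (b zero * 1/ g)               ≡⟨ solve 3 (λ g b h → g :* (b :* h) := b :* (g :* h)) refl g (b zero) (1/ g) ⟩
          b zero * (g * 1/ g)               ≡⟨ cong (b zero *_) (ℚP.*-inverseʳ g) ⟩
          b zero * 1ℚ                       ≡⟨ ℚP.*-identityʳ (b zero) ⟩
          b zero                            ∎
      ; (suc i) → begin
          ι (A (suc i) zero) * x₀ + (ι ∘ minor A i) · x  ≡⟨ cong (_+_ (ι (A (suc i) zero) * x₀)) (eqs i) ⟩
          ι (A (suc i) zero) * x₀ + b′ i                 ≡⟨ solve 3 (λ a x c → a :* x :+ (c :+ a :* (:- x)) := c)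
                                                                    refl (ι (A (suc i) zero)) x₀ (b (suc i)) ⟩
          b (suc i)                                      ∎
      }
      where open ≡-Reasoning

    certificate : HasCertificateℚ p (minor A) b′ → HasCertificateℚ p A b
    certificate (y , yA-int , yb′-not-padic) = y₀ ∷ y , yA′-int , yb′-not-padic ∘ subst (IsPAdic p) yb≡yb′
      where
      open ≡-Reasoning
      S = y · λ i → ι (A (suc i) zero)
      y₀ = - (S * 1/ g)
      yA′-int : ∀ j → IsIntegral ((y₀ ∷ y) · λ i → ι (A i j))
      yA′-int zero    = 0ℤ , (begin
        y₀ * g + S          ≡⟨ solve 3 (λ S h g → :- (S :* h) :* g :+ S := S :- S :* (h :* g)) refl S (1/ g) g ⟩
        S - S * (1/ g * g)  ≡⟨ cong (λ z → S - S * z) (ℚP.*-inverseˡ g) ⟩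
        S - S * 1ℚ          ≡⟨ cong (_-_ S) (ℚP.*-identityʳ S) ⟩
        S - S               ≡⟨ ℚP.+-inverseʳ S ⟩
        0ℚ                  ∎)
      yA′-int (suc j) = subst IsIntegral (sym (begin
        y₀ * ι (A zero (suc j)) + T  ≡⟨ cong (λ a → y₀ * ι a + T) (row-cleared j) ⟩
        y₀ * 0ℚ + T                  ≡⟨ cong (_+ T) (ℚP.*-zeroʳ y₀) ⟩
        0ℚ + T                       ≡⟨ ℚP.+-identityˡ T ⟩
        T                            ∎)) (yA-int j)
        where T = y · λ i → ι (minor A i j)
      yb≡yb′ : (y₀ ∷ y) · b ≡ y · b′
      yb≡yb′ = begin
        y₀ * b zero + y · tail b
          ≡⟨ solve 4 (λ S h c T → :- (S :* h) :* c :+ T := T :+ S :* (:- (c :* h))) refl S (1/ g) (b zero) (y · tail b) ⟩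
        y · tail b + S * - x₀
          ≡⟨ cong (_+_ (y · tail b)) (·-*ʳ y (λ i → ι (A (suc i) zero)) (- x₀)) ⟨
        y · tail b + y · (λ i → ι (A (suc i) zero) * - x₀)
          ≡⟨ ·-distribˡ-+ y (tail b) (λ i → ι (A (suc i) zero) * - x₀) ⟨
        y · b′
          ∎

module _ {p : ℕ} (p-prime : Prime p) where

  zeroRowStep : ∀ {m n} (A : Matrix (suc m) n) b → (∀ j → A zero j ≡ 0ℤ) →
                Alternative p (tail A) (tail b) → Alternative p A b
  zeroRowStep A b row-zero alt with b zero ℚP.≟ 0ℚ
  ... | yes b₀≡0 = Sum.map (solution b₀≡0) certificate alt
    where open DropZeroRow {A = A} {b} row-zero
  ... | no b₀≢0  = inj₂ (singleRowCertificate {A = A} {b} t tA-int tb-not-padic)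
    where
    instance
      b₀-nonZero : ℚ.NonZero (b zero)
      b₀-nonZero = ℚ.≢-nonZero b₀≢0
    t = 1/[1+ p ] * 1/ b zero
    tA-int : ∀ j → IsIntegral (t * ι (A zero j))
    tA-int j = 0ℤ , trans (cong (λ a → t * ι a) (row-zero j)) (ℚP.*-zeroʳ t)
    tb-not-padic : ¬ IsPAdic p (t * b zero)
    tb-not-padic = ¬IsPAdic-1/[1+p] p-prime ∘ subst (IsPAdic p) (begin
      1/[1+ p ] * 1/ b zero * b zero    ≡⟨ ℚP.*-assoc 1/[1+ p ] (1/ b zero) (b zero) ⟩
      1/[1+ p ] * (1/ b zero * b zero)  ≡⟨ cong (1/[1+ p ] *_) (ℚP.*-inverseˡ (b zero)) ⟩
      1/[1+ p ] * 1ℚ                    ≡⟨ ℚP.*-identityʳ 1/[1+ p ] ⟩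
      1/[1+ p ]                         ∎)
      where open ≡-Reasoning

  pivotStep : ∀ {m n} (A : Matrix (suc m) (suc n)) b → (∀ i → IsPAdic p (b i)) →
              A zero zero ≢ 0ℤ → (∀ j → A zero (suc j) ≡ 0ℤ) →
              (∀ b′ → (∀ i → IsPAdic p (b′ i)) → Alternative p (minor A) b′) → Alternative p A b
  pivotStep A b b-padic g≢0 row-cleared alternative-minor = decide (IsPAdic? p-prime x₀)
    where
    open Pivot A b g≢0 row-cleared
    decide : Dec (IsPAdic p x₀) → Alternative p A b
    decide (no  x₀-not-padic) = inj₂ (certificate-for-x₀ x₀-not-padic)
    decide (yes x₀-padic)     =
      Sum.map (solution x₀-padic) certificate (alternative-minor b′ (b′-padic b-padic x₀-padic))

  alternative : ∀ m n (A : Matrix m n) b → (∀ i → IsPAdic p (b i)) → Alternative p A b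
  alternative zero    n       A b _       = inj₁ ((λ _ → 0ℚ) , (λ _ → IsPAdic-ι 0ℤ) , λ ())
  alternative (suc m) zero    A b b-padic =
    zeroRowStep A b (λ ()) (alternative m zero (tail A) (tail b) (b-padic ∘ suc))
  alternative (suc m) (suc n) A b b-padic with clearFirstRow {p = p} A
  ... | A′ , A⇝A′ , row-cleared = Reduction.alternative A⇝A′ (zeroOrPivot (A′ zero zero ℤP.≟ 0ℤ))
    where
    zeroOrPivot : Dec (A′ zero zero ≡ 0ℤ) → Alternative p A′ b
    zeroOrPivot (yes g≡0) = zeroRowStep A′ b (λ { zero → g≡0 ; (suc j) → row-cleared j })
                              (alternative m (suc n) (tail A′) (tail b) (b-padic ∘ suc))
    zeroOrPivot (no g≢0)  = pivotStep A′ b b-padic g≢0 row-cleared (alternative m n (minor A′))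

lemma2p3 : (p : ℕ) → Prime p → (m n : ℕ) → (A : Fin m → Fin n → ℤ) → (b : Fin m → ℤ) →
    (HasPAdicSolution p A b ⊎ HasCertificate p A b) ×
    ¬ (HasPAdicSolution p A b × HasCertificate p A b)
lemma2p3 p p-prime m n A b =
    alternative p-prime m n A (ι ∘ b) (λ i → IsPAdic-ι (b i))
  , λ (solution , certificate) → solution⇒¬certificate {A = A} solution certificate
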